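{- Let $J$ be a feasible job set of one agent, $e$ an event scheduled at slot $t^e$, $\pi$ an ordering of $J$ by ascending deadlines and $\bar\pi$ an ordering of $J$ by descending release times, and $\hat j\in J$ a job whose interval contains $t^e$. Consider the algorithm: (Stage 1) for $t=1,\dots,t^e-1$, among jobs $j$ with $t\in I_j$ and remaining processing time $>0$, schedule at $t$ the one with smallest $\pi(j)$ and decrease its remaining processing time by one; (Stage 2) move $\hat j$ to the last position of $\bar\pi$ keeping the relative order of the others, and for $t=|T|,|T|-1,\dots,t^e$, among jobs $j$ with $t\in I_j$ and remaining processing time $>0$, schedule at $t$ the one with smallest (modified) $\bar\pi(j)$ and decrease its remaining processing time by one. Then the resulting job schedule is an optimal job schedule for $J$ when the event is scheduled at $t^e$, i.e., it is feasible and maximizes the number of slots occupied by the event in which no job is processed.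
   Context: Discrete time slots $T=\{1,\dots,|T|\}$. Jobs $j$ have release time $r_j$, deadline $d_j$, processing time $p_j\le d_j-r_j+1$ and interval $I_j=\{r_j,\dots,d_j\}$; a preemptive job schedule is feasible if each job gets $p_j$ distinct slots of its interval and each slot holds at most one job; $J$ admits a feasible schedule. The event $e$ has length $l(e)$ and, scheduled at $t^e$, occupies $\{t^e,\dots,t^e+l(e)-1\}$. -}

module Defs where

open import Data.Nat using (ℕ; zero; suc; _+_; _∸_; _≤_; _<_; _≤ᵇ_; _<ᵇ_)
open import Data.Bool using (Bool; true; false; if_then_else_; _∧_)
open import Data.Fin as Fin using (Fin; toℕ)
open import Data.Fin.Permutation using (Permutation′; _⟨$⟩ʳ_)
open import Data.Maybe using (Maybe; just; nothing; is-nothing)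
open import Data.List using (List; []; _∷_; map; upTo; foldr; reverse; filter; length; allFin)
open import Data.Product using (_×_; _,_; ∃)
open import Relation.Nullary using (does)
open import Relation.Binary.PropositionalEquality using (_≡_)

-- A job: release time r, deadline d, processing time p; interval I = {r,…,d}.
record Job : Set where
  constructor job
  field
    r d p : ℕ
open Job public

-- A (preemptive) job schedule: slot ↦ job processed there (or none).
-- At most one job per slot holds by construction.
Schedule : ℕ → Set
Schedule n = ℕ → Maybe (Fin n)

isJob : ∀ {n} → Maybe (Fin n) → Fin n → Bool
isJob nothing  j = false
isJob (just k) j = does (k Fin.≟ j)

count : (ℕ → Bool) → List ℕ → ℕ
count f ts = length (filter (λ t → f t Data.Bool.≟ true) ts)
  where import Data.Bool

range : ℕ → ℕ → List ℕ
range a k = map (a +_) (upTo k)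

slotsT : ℕ → List ℕ
slotsT H = range 1 H

Feasible : ∀ {n} → (Fin n → Job) → ℕ → Schedule n → Set
Feasible {n} J H s =
  (∀ (t : ℕ) (j : Fin n) → s t ≡ just j →
      (1 ≤ t) × (t ≤ H) × (r (J j) ≤ t) × (t ≤ d (J j)))
  × (∀ (j : Fin n) → count (λ t → isJob (s t) j) (slotsT H) ≡ p (J j))

-- number of slots occupied by the event (at te, length l) with no job processed
idleEventSlots : ∀ {n} → Schedule n → ℕ → ℕ → ℕ
idleEventSlots s te l = count (λ t → is-nothing (s t)) (range te l)

Optimal : ∀ {n} → (Fin n → Job) → ℕ → ℕ → ℕ → Schedule n → Set
Optimal J H te l s =
  Feasible J H s × (∀ s' → Feasible J H s' → idleEventSlots s' te l ≤ idleEventSlots s te l)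

available : ∀ {n} → (Fin n → Job) → (Fin n → ℕ) → ℕ → Fin n → Bool
available J rem t j = (r (J j) ≤ᵇ t) ∧ (t ≤ᵇ d (J j)) ∧ (1 ≤ᵇ rem j)

-- the candidate with the smallest rank (ranks come from an ordering, so injective)
selectMin : ∀ {n} → (Fin n → ℕ) → (Fin n → Bool) → Maybe (Fin n)
selectMin {n} rank ok = foldr step nothing (allFin n)
  where
  step : Fin _ → Maybe (Fin _) → Maybe (Fin _)
  step j nothing  = if ok j then just j else nothing
  step j (just k) = if ok j then (if rank j <ᵇ rank k then just j else just k) else just k

decr : ∀ {n} → (Fin n → ℕ) → Fin n → (Fin n → ℕ)
decr rem j k = if does (k Fin.≟ j) then rem k ∸ 1 else rem k

assign : ∀ {n} → Schedule n → ℕ → Fin n → Schedule n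
assign s t j t' = if does (t' Data.Nat.≟ t) then just j else s t'
  where import Data.Nat

runSlots : ∀ {n} → (Fin n → Job) → (Fin n → ℕ) → List ℕ →
           (Fin n → ℕ) → Schedule n → (Fin n → ℕ) × Schedule n
runSlots J rank [] rem s = rem , s
runSlots J rank (t ∷ ts) rem s with selectMin rank (available J rem t)
... | nothing = runSlots J rank ts rem s
... | just j  = runSlots J rank ts (decr rem j) (assign s t j)

-- position of j in π̄ after moving ĵ to the last position (relative order of others kept)
moveLast : ∀ {n} → Permutation′ n → Fin n → Fin n → ℕ
moveLast {n} π̄ ĵ j =
  if does (j Fin.≟ ĵ) then n ∸ 1
  else (if toℕ (π̄ ⟨$⟩ʳ ĵ) <ᵇ toℕ (π̄ ⟨$⟩ʳ j) then toℕ (π̄ ⟨$⟩ʳ j) ∸ 1 else toℕ (π̄ ⟨$⟩ʳ j))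

algorithm : ∀ {n} → (Fin n → Job) → ℕ → ℕ → Permutation′ n → Permutation′ n → Fin n → Schedule n
algorithm J H te π π̄ ĵ with runSlots J (λ j → toℕ (π ⟨$⟩ʳ j)) (range 1 (te ∸ 1)) (λ j → p (J j)) (λ _ → nothing)
... | rem₁ , s₁ with runSlots J (moveLast π̄ ĵ) (reverse (range te (suc H ∸ te))) rem₁ s₁
...   | _ , s₂ = s₂

AscDeadline : ∀ {n} → (Fin n → Job) → Permutation′ n → Set
AscDeadline J π = ∀ i j → π ⟨$⟩ʳ i Fin.< π ⟨$⟩ʳ j → d (J i) ≤ d (J j)

DescRelease : ∀ {n} → (Fin n → Job) → Permutation′ n → Set
DescRelease J π̄ = ∀ i j → π̄ ⟨$⟩ʳ i Fin.< π̄ ⟨$⟩ʳ j → r (J j) ≤ r (J i)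

{-# OPTIONS --safe #-}
module Submission where

-- Exchange argument. Fix any feasible schedule σ and follow the algorithm slot by slot,
-- keeping σ feasible, in agreement with every slot already filled, running each job on the
-- undecided slots exactly as often as its remaining processing time, and with at least as
-- many idle event slots as at the start. If the algorithm leaves t empty, no job with
-- remaining time is available at t, so σ leaves t empty too. If it puts j at t while σ does
-- not, then σ runs j at some undecided slot t', and we swap the contents of t and t'. The job
-- k that σ ran at t has no higher priority than j, so it may run at t': in stage 1, t < t'
-- and d_j ≤ d_k; in stage 2, t' < t and r_k ≤ r_j, except for k = ĵ, which has the lowest
-- priority but satisfies r_ĵ ≤ t^e ≤ t'. A swap can only make t busy and t' idle, so no idle
-- event slot is lost as long as t' lies in the event window whenever t does: stage 1 slots
-- precede the window, and in stage 2, t^e ≤ t' < t.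

open import Defs
open import Data.Bool using (Bool; true; false; T; if_then_else_)
open import Data.Bool.Properties using (T-∧)
open import Data.Fin as Fin using (Fin; toℕ)
open import Data.Fin.Properties using (toℕ-injective; toℕ<n)
open import Data.Fin.Permutation using (Permutation′; _⟨$⟩ʳ_)
open import Data.List using (List; []; _∷_; _++_; reverse; applyUpTo; applyDownFrom; allFin; foldr)
open import Data.List.Properties using (map-upTo; reverse-applyUpTo; foldr-cong; ++-identityʳ)
open import Data.List.Membership.Propositional using (_∈_; _∉_)
open import Data.List.Membership.Propositional.Properties using (∈-applyUpTo⁺; ∈-applyUpTo⁻; ∈-allFin)
import Data.List.Relation.Unary.All as All
open import Data.List.Relation.Unary.AllPairs as AllPairs using (AllPairs; _∷_)
open import Data.List.Relation.Unary.AllPairs.Properties using (applyUpTo⁺₁; applyDownFrom⁺₁)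
open import Data.List.Relation.Unary.Any using (here; there)
open import Data.List.Relation.Unary.Unique.Propositional using (Unique)
open import Data.List.Relation.Binary.Permutation.Propositional using (_↭_; ↭-sym; ↭-trans; ↭-reflexive)
open import Data.List.Relation.Binary.Permutation.Propositional.Properties using (filter-↭; ↭-length; ∈-resp-↭; ↭-reverse)
open import Data.Maybe using (Maybe; just; nothing; is-nothing)
open import Data.Maybe.Properties using (just-injective)
open import Data.Nat using (ℕ; zero; suc; _+_; _∸_; _≤_; _<_; _<ᵇ_; s≤s; z≤n)
open import Data.Nat.Properties
open import Data.List.Membership.DecPropositional _≟_ using (_∈?_)
open import Data.Product using (_×_; _,_; ∃; ∃-syntax; proj₁; proj₂)
open import Function using (_∘_; case_of_)
open import Function.Bundles using (module Equivalence; module Injection)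
open import Function.Properties.Inverse using (↔⇒↣)
open Equivalence using (to; from)
open import Algebra.Properties.CommutativeSemigroup +-commutativeSemigroup using (x∙yz≈y∙xz)
open import Relation.Binary.PropositionalEquality
open import Relation.Binary.Definitions using (tri<; tri≈; tri>)
open import Relation.Nullary using (¬_; Dec; does; yes; no; contradiction; ofʸ; ofⁿ)
open import Relation.Nullary.Decidable using (dec-true; dec-false)

indicator : Bool → ℕ
indicator true  = 1
indicator false = 0

count-∷ : ∀ f x xs → count f (x ∷ xs) ≡ indicator (f x) + count f xs
count-∷ f x xs with f x
... | true  = refl
... | false = refl

count-cong : ∀ {f g} xs → (∀ {x} → x ∈ xs → f x ≡ g x) → count f xs ≡ count g xs
count-cong []       f≗g = refl
count-cong {f} {g} (x ∷ xs) f≗g = begin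
  count f (x ∷ xs)              ≡⟨ count-∷ f x xs ⟩
  indicator (f x) + count f xs  ≡⟨ cong₂ _+_ (cong indicator (f≗g (here refl))) (count-cong xs (f≗g ∘ there)) ⟩
  indicator (g x) + count g xs  ≡⟨ count-∷ g x xs ⟨
  count g (x ∷ xs)              ∎
  where open ≡-Reasoning

count-resp-↭ : ∀ f {xs ys} → xs ↭ ys → count f xs ≡ count f ys
count-resp-↭ f xs↭ys = ↭-length (filter-↭ _ xs↭ys)

count-witness : ∀ f xs → 0 < count f xs → ∃[ x ] x ∈ xs × f x ≡ true
count-witness f (x ∷ xs) pos with f x in fx | count-∷ f x xs
... | true  | _ = x , here refl , fx
... | false | eq with count-witness f xs (subst (0 <_) eq pos)
...   | y , y∈xs , fy = y , there y∈xs , fy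

∉-∷⁺ : ∀ {A : Set} {x t : A} {U} → x ≢ t → x ∉ U → x ∉ t ∷ U
∉-∷⁺ x≢t x∉U (here x≡t)  = x≢t x≡t
∉-∷⁺ x≢t x∉U (there x∈U) = x∉U x∈U

module _ {A : Set} where

  update : (ℕ → A) → ℕ → A → ℕ → A
  update f p v x = if does (x ≟ p) then v else f x

  update-≡ : ∀ f p v → update f p v p ≡ v
  update-≡ f p v rewrite dec-true (p ≟ p) refl = refl

  update-≢ : ∀ f {p} v {x} → x ≢ p → update f p v x ≡ f x
  update-≢ f {p} v {x} x≢p rewrite dec-false (x ≟ p) x≢p = refl

  swapSlots : (ℕ → A) → ℕ → ℕ → ℕ → A
  swapSlots f t t' = update (update f t (f t')) t' (f t)

  swapSlots-≡ˡ : ∀ f {t t'} → t ≢ t' → swapSlots f t t' t ≡ f t'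
  swapSlots-≡ˡ f {t} {t'} t≢t' = trans (update-≢ (update f t (f t')) (f t) t≢t') (update-≡ f t (f t'))

  swapSlots-≡ʳ : ∀ f t t' → swapSlots f t t' t' ≡ f t
  swapSlots-≡ʳ f t t' = update-≡ (update f t (f t')) t' (f t)

  swapSlots-≢ : ∀ f {t t' x} → x ≢ t → x ≢ t' → swapSlots f t t' x ≡ f x
  swapSlots-≢ f {t} {t'} x≢t x≢t' = trans (update-≢ (update f t (f t')) (f t) x≢t') (update-≢ f (f t') x≢t)

  module _ (g : A → Bool) where

    count-update-∉ : ∀ f {p} v {xs} → p ∉ xs → count (g ∘ update f p v) xs ≡ count (g ∘ f) xs
    count-update-∉ f v {xs} p∉xs =
      count-cong xs (λ x∈xs → cong g (update-≢ f v λ { refl → p∉xs x∈xs }))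

    count-update-∈ : ∀ f {p} v {xs} → Unique xs → p ∈ xs →
      indicator (g (f p)) + count (g ∘ update f p v) xs ≡ indicator (g v) + count (g ∘ f) xs
    count-update-∈ f {p} v {p ∷ xs} (p∉xs ∷ _) (here refl) = begin
      indicator (g (f p)) + count (g ∘ update f p v) (p ∷ xs)
        ≡⟨ cong (indicator (g (f p)) +_) (count-∷ _ p xs) ⟩
      indicator (g (f p)) + (indicator (g (update f p v p)) + count (g ∘ update f p v) xs)
        ≡⟨ cong₂ (λ a c → indicator (g (f p)) + (indicator (g a) + c))
                 (update-≡ f p v) (count-update-∉ f v (λ p∈xs → All.lookup p∉xs p∈xs refl)) ⟩
      indicator (g (f p)) + (indicator (g v) + count (g ∘ f) xs)
        ≡⟨ x∙yz≈y∙xz (indicator (g (f p))) (indicator (g v)) _ ⟩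
      indicator (g v) + (indicator (g (f p)) + count (g ∘ f) xs)
        ≡⟨ cong (indicator (g v) +_) (count-∷ _ p xs) ⟨
      indicator (g v) + count (g ∘ f) (p ∷ xs) ∎
      where open ≡-Reasoning
    count-update-∈ f {p} v {x ∷ xs} (x∉xs ∷ u) (there p∈xs) = begin
      indicator (g (f p)) + count (g ∘ update f p v) (x ∷ xs)
        ≡⟨ cong (indicator (g (f p)) +_) (count-∷ _ x xs) ⟩
      indicator (g (f p)) + (indicator (g (update f p v x)) + count (g ∘ update f p v) xs)
        ≡⟨ cong (λ a → indicator (g (f p)) + (indicator (g a) + _)) (update-≢ f v (All.lookup x∉xs p∈xs)) ⟩
      indicator (g (f p)) + (indicator (g (f x)) + count (g ∘ update f p v) xs)
        ≡⟨ x∙yz≈y∙xz (indicator (g (f p))) (indicator (g (f x))) _ ⟩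
      indicator (g (f x)) + (indicator (g (f p)) + count (g ∘ update f p v) xs)
        ≡⟨ cong (indicator (g (f x)) +_) (count-update-∈ f v u p∈xs) ⟩
      indicator (g (f x)) + (indicator (g v) + count (g ∘ f) xs)
        ≡⟨ x∙yz≈y∙xz (indicator (g (f x))) (indicator (g v)) _ ⟩
      indicator (g v) + (indicator (g (f x)) + count (g ∘ f) xs)
        ≡⟨ cong (indicator (g v) +_) (count-∷ _ x xs) ⟨
      indicator (g v) + count (g ∘ f) (x ∷ xs) ∎
      where open ≡-Reasoning

    count-swapSlots-∈ : ∀ f {t t' xs} → Unique xs → t ≢ t' → t ∈ xs → t' ∈ xs →
      count (g ∘ swapSlots f t t') xs ≡ count (g ∘ f) xs
    count-swapSlots-∈ f {t} {t'} {xs} u t≢t' t∈xs t'∈xs = +-cancelˡ-≡ (indicator (g (f t'))) _ _ (begin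
      indicator (g (f t')) + count (g ∘ swapSlots f t t') xs
        ≡⟨ cong (λ a → indicator (g a) + count (g ∘ swapSlots f t t') xs) (update-≢ f (f t') (t≢t' ∘ sym)) ⟨
      indicator (g (update f t (f t') t')) + count (g ∘ swapSlots f t t') xs
        ≡⟨ count-update-∈ (update f t (f t')) (f t) u t'∈xs ⟩
      indicator (g (f t)) + count (g ∘ update f t (f t')) xs
        ≡⟨ count-update-∈ f (f t') u t∈xs ⟩
      indicator (g (f t')) + count (g ∘ f) xs ∎)
      where open ≡-Reasoning

    count-swapSlots-∉ : ∀ f {t t' xs} → t ∉ xs → t' ∉ xs →
      count (g ∘ swapSlots f t t') xs ≡ count (g ∘ f) xs
    count-swapSlots-∉ f {t} {t'} t∉xs t'∉xs =
      trans (count-update-∉ (update f t (f t')) (f t) t'∉xs) (count-update-∉ f (f t') t∉xs)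

    count-swapSlots-≤ : ∀ f {t t' xs} → Unique xs → t ≢ t' → (t ∈ xs → t' ∈ xs) → g (f t') ≡ false →
      count (g ∘ f) xs ≤ count (g ∘ swapSlots f t t') xs
    count-swapSlots-≤ f {t} {t'} {xs} u t≢t' t'∈xs⇐ gft' with t ∈? xs | t' ∈? xs
    ... | yes t∈xs | _         = ≤-reflexive (sym (count-swapSlots-∈ f u t≢t' t∈xs (t'∈xs⇐ t∈xs)))
    ... | no  t∉xs | no  t'∉xs = ≤-reflexive (sym (count-swapSlots-∉ f t∉xs t'∉xs))
    ... | no  t∉xs | yes t'∈xs = begin
      count (g ∘ f) xs                                   ≤⟨ m≤n+m _ _ ⟩
      indicator (g (f t)) + count (g ∘ f) xs             ≡⟨ cong (indicator (g (f t)) +_) (count-update-∉ f (f t') t∉xs) ⟨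
      indicator (g (f t)) + count (g ∘ update f t (f t')) xs
        ≡⟨ count-update-∈ (update f t (f t')) (f t) u t'∈xs ⟨
      indicator (g (update f t (f t') t')) + count (g ∘ swapSlots f t t') xs
        ≡⟨ cong (λ a → indicator (g a) + count (g ∘ swapSlots f t t') xs) (update-≢ f (f t') (t≢t' ∘ sym)) ⟩
      indicator (g (f t')) + count (g ∘ swapSlots f t t') xs
        ≡⟨ cong (λ b → indicator b + count (g ∘ swapSlots f t t') xs) gft' ⟩
      count (g ∘ swapSlots f t t') xs                    ∎
      where open ≤-Reasoning

range≡applyUpTo : ∀ a k → range a k ≡ applyUpTo (a +_) k
range≡applyUpTo a = map-upTo (a +_)

applyUpTo-++ : ∀ {A : Set} (f : ℕ → A) m k → applyUpTo f m ++ applyUpTo (f ∘ (m +_)) k ≡ applyUpTo f (m + k)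
applyUpTo-++ f zero    k = refl
applyUpTo-++ f (suc m) k = cong (f 0 ∷_) (applyUpTo-++ (f ∘ suc) m k)

range-split : ∀ {te H} → 1 ≤ te → te ≤ suc H → range 1 (te ∸ 1) ++ range te (suc H ∸ te) ≡ range 1 H
range-split {suc u} {H} _ (s≤s u≤H) = begin
  range 1 u ++ range (suc u) (H ∸ u)
    ≡⟨ cong₂ _++_ (range≡applyUpTo 1 u) (range≡applyUpTo (suc u) (H ∸ u)) ⟩
  applyUpTo suc u ++ applyUpTo (suc u +_) (H ∸ u)  ≡⟨ applyUpTo-++ suc u (H ∸ u) ⟩
  applyUpTo suc (u + (H ∸ u))                      ≡⟨ cong (applyUpTo suc) (m+[n∸m]≡n u≤H) ⟩
  applyUpTo suc H                                  ≡⟨ range≡applyUpTo 1 H ⟨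
  range 1 H                                        ∎
  where open ≡-Reasoning

reverse-range : ∀ a k → reverse (range a k) ≡ applyDownFrom (a +_) k
reverse-range a k = trans (cong reverse (range≡applyUpTo a k)) (reverse-applyUpTo (a +_) k)

∈-range⁻ : ∀ {a k x} → x ∈ range a k → a ≤ x × x < a + k
∈-range⁻ {a} {k} x∈ with ∈-applyUpTo⁻ (a +_) (subst (_ ∈_) (range≡applyUpTo a k) x∈)
... | i , i<k , refl = m≤m+n a i , +-monoʳ-< a i<k

∈-range⁺ : ∀ {a k x} → a ≤ x → x < a + k → x ∈ range a k
∈-range⁺ {a} {k} {x} a≤x x<a+k =
  subst₂ _∈_ (m+[n∸m]≡n a≤x) (sym (range≡applyUpTo a k))
    (∈-applyUpTo⁺ (a +_) (+-cancelˡ-< a _ _ (subst (_< a + k) (sym (m+[n∸m]≡n a≤x)) x<a+k)))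

range-increasing : ∀ a k → AllPairs _<_ (range a k)
range-increasing a k = subst (AllPairs _<_) (sym (range≡applyUpTo a k)) (applyUpTo⁺₁ (a +_) k λ i<j _ → +-monoʳ-< a i<j)

range-unique : ∀ a k → Unique (range a k)
range-unique a k = AllPairs.map <⇒≢ (range-increasing a k)

module _ {n} (rank : Fin n → ℕ) (ok : Fin n → Bool) where

  data Argmin (xs : List (Fin n)) : Maybe (Fin n) → Set where
    none : (∀ {k} → k ∈ xs → ¬ T (ok k)) → Argmin xs nothing
    some : ∀ {j} → T (ok j) → (∀ {k} → k ∈ xs → T (ok k) → rank j ≤ rank k) → Argmin xs (just j)

  private
    minStep : Fin n → Maybe (Fin n) → Maybe (Fin n)
    minStep j nothing  = if ok j then just j else nothing
    minStep j (just k) = if ok j then (if rank j <ᵇ rank k then just j else just k) else just k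

    argmin-∷ : ∀ x {xs m} → Argmin xs m → Argmin (x ∷ xs) (minStep x m)
    argmin-∷ x (none none-ok) with ok x in okx
    ... | true  = some (subst T (sym okx) _) λ where
                    (here refl) _     → ≤-refl
                    (there k∈)  ok[k] → contradiction ok[k] (none-ok k∈)
    ... | false = none λ where
                    (here refl) → subst T okx
                    (there k∈)  → none-ok k∈
    argmin-∷ x (some {j} ok[j] min) with ok x in okx
    ... | false = some ok[j] λ where
                    (here refl) ok[x] → contradiction (subst T okx ok[x]) λ ()
                    (there k∈)        → min k∈
    ... | true with rank x <ᵇ rank j | <ᵇ-reflects-< (rank x) (rank j)
    ...   | true  | ofʸ x<j = some (subst T (sym okx) _) λ where
                                (here refl) _     → ≤-refl
                                (there k∈)  ok[k] → ≤-trans (<⇒≤ x<j) (min k∈ ok[k])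
    ...   | false | ofⁿ x≮j = some ok[j] λ where
                                (here refl) _ → ≮⇒≥ x≮j
                                (there k∈)    → min k∈

    argmin-foldr : ∀ xs → Argmin xs (foldr minStep nothing xs)
    argmin-foldr []       = none λ ()
    argmin-foldr (x ∷ xs) = argmin-∷ x (argmin-foldr xs)

  selectMin-argmin : Argmin (allFin n) (selectMin rank ok)
  selectMin-argmin = subst (Argmin (allFin n))
    (foldr-cong (λ { _ nothing → refl ; _ (just _) → refl }) refl (allFin n))
    (argmin-foldr (allFin n))

permute-injective : ∀ {n} (π : Permutation′ n) {i j} → toℕ (π ⟨$⟩ʳ i) ≡ toℕ (π ⟨$⟩ʳ j) → i ≡ j
permute-injective π = Injection.injective (↔⇒↣ π) ∘ toℕ-injective

shiftDown : ℕ → ℕ → ℕ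
shiftDown h v = if h <ᵇ v then v ∸ 1 else v

shiftDown<pred : ∀ {h v m} → v ≢ h → v < m → h < m → shiftDown h v < m ∸ 1
shiftDown<pred {h} {v} {m} v≢h v<m h<m with h <ᵇ v | <ᵇ-reflects-< h v
... | true  | ofʸ h<v = ∸-monoˡ-< v<m (≤-<-trans z≤n h<v)
... | false | ofⁿ h≮v = <-≤-trans (≤∧≢⇒< (≮⇒≥ h≮v) v≢h) (<⇒≤pred h<m)

shiftDown-mono-< : ∀ {h a b} → a ≢ h → a < b → shiftDown h a < shiftDown h b
shiftDown-mono-< {h} {a} {b} a≢h a<b with h <ᵇ a | <ᵇ-reflects-< h a | h <ᵇ b | <ᵇ-reflects-< h b
... | true  | ofʸ h<a | true  | _       = ∸-monoˡ-< a<b (≤-<-trans z≤n h<a)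
... | true  | ofʸ h<a | false | ofⁿ h≮b = contradiction (<-trans h<a a<b) h≮b
... | false | ofⁿ h≮a | true  | ofʸ h<b = <-≤-trans (≤∧≢⇒< (≮⇒≥ h≮a) a≢h) (<⇒≤pred h<b)
... | false | _       | false | _       = a<b

module _ {n} (π̄ : Permutation′ n) (ĵ : Fin n) where

  private
    position : Fin n → ℕ
    position j = toℕ (π̄ ⟨$⟩ʳ j)

  moveLast-≡ : moveLast π̄ ĵ ĵ ≡ n ∸ 1
  moveLast-≡ rewrite dec-true (ĵ Fin.≟ ĵ) refl = refl

  moveLast-≢ : ∀ {k} → k ≢ ĵ → moveLast π̄ ĵ k ≡ shiftDown (position ĵ) (position k)
  moveLast-≢ {k} k≢ĵ rewrite dec-false (k Fin.≟ ĵ) k≢ĵ = refl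

  moveLast-≤⇒< : ∀ {j k} → k ≢ ĵ → j ≢ k → moveLast π̄ ĵ j ≤ moveLast π̄ ĵ k → π̄ ⟨$⟩ʳ j Fin.< π̄ ⟨$⟩ʳ k
  moveLast-≤⇒< {j} {k} k≢ĵ j≢k j≤k = compare (j Fin.≟ ĵ)
    where
    compare : Dec (j ≡ ĵ) → π̄ ⟨$⟩ʳ j Fin.< π̄ ⟨$⟩ʳ k
    compare (yes refl) = contradiction (subst₂ _≤_ moveLast-≡ (moveLast-≢ k≢ĵ) j≤k)
      (<⇒≱ (shiftDown<pred (k≢ĵ ∘ permute-injective π̄) (toℕ<n _) (toℕ<n _)))
    compare (no j≢ĵ) with <-cmp (position j) (position k)
    ... | tri< j<k _ _ = j<k
    ... | tri≈ _ j≡k _ = contradiction (permute-injective π̄ j≡k) j≢k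
    ... | tri> _ _ k<j = contradiction (subst₂ _≤_ (moveLast-≢ j≢ĵ) (moveLast-≢ k≢ĵ) j≤k)
      (<⇒≱ (shiftDown-mono-< (k≢ĵ ∘ permute-injective π̄) k<j))

Fits : Job → ℕ → Set
Fits x t = r x ≤ t × t ≤ d x

Admissible : ∀ {n} → (Fin n → Job) → ℕ → Maybe (Fin n) → ℕ → Set
Admissible J H c t = ∀ j → c ≡ just j → (1 ≤ t) × (t ≤ H) × Fits (J j) t

module _ {n : ℕ} where

  isJob-self : (j : Fin n) → isJob (just j) j ≡ true
  isJob-self j = dec-true (j Fin.≟ j) refl

  isJob⇒≡ : ∀ c {j : Fin n} → isJob c j ≡ true → c ≡ just j
  isJob⇒≡ (just k) {j} e with k Fin.≟ j | e
  ... | yes refl | _  = refl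
  ... | no _     | ()

  isJob-≢ : ∀ {c} {j : Fin n} → c ≢ just j → isJob c j ≡ false
  isJob-≢ {nothing} c≢j = refl
  isJob-≢ {just k} {j} c≢j = dec-false (k Fin.≟ j) (c≢j ∘ cong just)

  decr-remaining : ∀ (rem : Fin n → ℕ) j k {c} → rem k ≡ indicator (isJob (just j) k) + c → decr rem j k ≡ c
  decr-remaining rem j k {c} eq with k Fin.≟ j
  ... | yes refl = cong (_∸ 1) (trans eq (cong (λ b → indicator b + c) (isJob-self k)))
  ... | no k≢j   = trans eq (cong (λ b → indicator b + c) (isJob-≢ (k≢j ∘ sym ∘ just-injective)))

  module _ (J : Fin n → Job) where

    available⁺ : ∀ {rem t j} → Fits (J j) t → 0 < rem j → T (available J rem t j)
    available⁺ (r≤t , t≤d) 0<rem = T-∧ .from (≤⇒≤ᵇ r≤t , T-∧ .from (≤⇒≤ᵇ t≤d , ≤⇒≤ᵇ 0<rem))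

    available⁻ : ∀ {rem t j} → T (available J rem t j) → Fits (J j) t × 0 < rem j
    available⁻ {rem} {t} {j} ok with T-∧ .to ok
    ... | r≤ᵇt , rest with T-∧ .to rest
    ...   | t≤ᵇd , 1≤ᵇrem = (≤ᵇ⇒≤ _ _ r≤ᵇt , ≤ᵇ⇒≤ _ _ t≤ᵇd) , ≤ᵇ⇒≤ 1 (rem j) 1≤ᵇrem

    module _ {H : ℕ} where

      admissible-just : ∀ {c j t} → c ≡ just j → (1 ≤ t) × (t ≤ H) × Fits (J j) t → Admissible J H c t
      admissible-just refl adm _ refl = adm

      admissible⇒∈slots : ∀ {c j t} → Admissible J H c t → c ≡ just j → t ∈ slotsT H
      admissible⇒∈slots adm e with adm _ e
      ... | 1≤t , t≤H , _ = ∈-range⁺ 1≤t (s≤s t≤H)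

      feasible-cong : ∀ {s σ} → (∀ x → s x ≡ σ x) → Feasible J H σ → Feasible J H s
      feasible-cong s≗σ (admissible , processed) =
        (λ x j e → admissible x j (trans (sym (s≗σ x)) e)) ,
        (λ j → trans (count-cong (slotsT H) (λ {x} _ → cong (λ c → isJob c j) (s≗σ x))) (processed j))

      feasible-swapSlots : ∀ {σ t t' j} → Feasible J H σ → t ≢ t' → σ t' ≡ just j →
        Admissible J H (σ t') t → Admissible J H (σ t) t' → Feasible J H (swapSlots σ t t')
      feasible-swapSlots {σ} {t} {t'} (admissible , processed) t≢t' σt'≡j adm adm' =
        admissible′ , λ j → trans (count-swapSlots-∈ (λ c → isJob c j) σ (range-unique 1 H) t≢t'
                                      (admissible⇒∈slots adm σt'≡j)
                                      (admissible⇒∈slots (admissible t') σt'≡j))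
                                   (processed j)
        where
        admissible′ : ∀ x → Admissible J H (swapSlots σ t t' x) x
        admissible′ x with x ≟ t | x ≟ t'
        ... | yes refl | _        = subst (λ c → Admissible J H c x) (sym (swapSlots-≡ˡ σ t≢t')) adm
        ... | no _     | yes refl = subst (λ c → Admissible J H c x) (sym (swapSlots-≡ʳ σ t t')) adm'
        ... | no x≢t   | no x≢t'  = subst (λ c → Admissible J H c x) (sym (swapSlots-≢ σ x≢t x≢t')) (admissible x)

module Exchange {n} (J : Fin n → Job) (H te l : ℕ) (intervals : ∀ j → 1 ≤ r (J j) × d (J j) ≤ H) where

  idle : Schedule n → ℕ
  idle σ = idleEventSlots σ te l

  record Completion (U : List ℕ) (rem : Fin n → ℕ) (s σ : Schedule n) : Set where
    field
      feasible  : Feasible J H σ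
      remaining : ∀ j → rem j ≡ count (λ x → isJob (σ x) j) U
      undecided : ∀ {x} → x ∈ U → s x ≡ nothing
      decided   : ∀ {x} → x ∉ U → s x ≡ σ x

  record Exchangeable (rank : Fin n → ℕ) (t t' : ℕ) : Set where
    field
      relocatable   : ∀ {j k} → rank j ≤ rank k → j ≢ k → Fits (J k) t → Fits (J j) t' → Fits (J k) t'
      window-closed : t ∈ range te l → t' ∈ range te l

  initial-completion : ∀ {σ} → Feasible J H σ → Completion (slotsT H) (λ j → p (J j)) (λ _ → nothing) σ
  initial-completion {σ} feasible = record
    { feasible  = feasible
    ; remaining = λ j → sym (proj₂ feasible j)
    ; undecided = λ _ → refl
    ; decided   = decided
    }
    where
    decided : ∀ {x} → x ∉ slotsT H → nothing ≡ σ x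
    decided {x} x∉slots with σ x in σx≡j
    ... | nothing = refl
    ... | just j  = contradiction (admissible⇒∈slots J (proj₁ feasible x) σx≡j) x∉slots

  completion-resp-↭ : ∀ {U U' rem s σ} → U ↭ U' → Completion U rem s σ → Completion U' rem s σ
  completion-resp-↭ U↭U' c = record
    { feasible  = feasible
    ; remaining = λ j → trans (remaining j) (count-resp-↭ _ U↭U')
    ; undecided = undecided ∘ ∈-resp-↭ (↭-sym U↭U')
    ; decided   = λ x∉U' → decided (x∉U' ∘ ∈-resp-↭ U↭U')
    }
    where open Completion c

  completion-[] : ∀ {rem s σ} → Completion [] rem s σ → Feasible J H s × idle s ≡ idle σ
  completion-[] c = feasible-cong J s≗σ feasible , count-cong (range te l) (λ {x} _ → cong is-nothing (s≗σ x))
    where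
    open Completion c
    s≗σ = λ x → decided {x} λ ()

  completion-swapSlots : ∀ {U rem s σ t t'} → Completion U rem s σ → Unique U → t ≢ t' → t ∈ U → t' ∈ U →
    Feasible J H (swapSlots σ t t') → Completion U rem s (swapSlots σ t t')
  completion-swapSlots {U} {σ = σ} c unique t≢t' t∈U t'∈U feasible′ = record
    { feasible  = feasible′
    ; remaining = λ j → trans (remaining j) (sym (count-swapSlots-∈ (λ c → isJob c j) σ unique t≢t' t∈U t'∈U))
    ; undecided = undecided
    ; decided   = λ x∉U → trans (decided x∉U) (sym (swapSlots-≢ σ (λ { refl → x∉U t∈U }) (λ { refl → x∉U t'∈U })))
    }
    where open Completion c

  module _ {t U rem s σ} (c : Completion (t ∷ U) rem s σ) where
    open Completion c

    private
      later : Fin n → ℕ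
      later k = count (λ x → isJob (σ x) k) U

    remaining-∷ : ∀ {c} → σ t ≡ c → ∀ k → rem k ≡ indicator (isJob c k) + later k
    remaining-∷ refl k = trans (remaining k) (count-∷ _ t U)

    occupant-available : ∀ {k} → σ t ≡ just k → T (available J rem t k)
    occupant-available {k} σt≡k = available⁺ J {rem} (proj₂ (proj₂ (proj₁ feasible t k σt≡k)))
      (subst (0 <_) (sym (trans (remaining-∷ σt≡k k) (cong (λ b → indicator b + later k) (isJob-self k)))) (s≤s z≤n))

    completion-skip : (∀ k → ¬ T (available J rem t k)) → Completion U rem s σ
    completion-skip unavailable = record
      { feasible  = feasible
      ; remaining = remaining-∷ σt≡nothing
      ; undecided = undecided ∘ there
      ; decided   = decided′
      }
      where
      σt≡nothing : σ t ≡ nothing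
      σt≡nothing with σ t in σt≡k
      ... | nothing = refl
      ... | just k  = contradiction (occupant-available σt≡k) (unavailable k)
      decided′ : ∀ {x} → x ∉ U → s x ≡ σ x
      decided′ {x} x∉U with x ≟ t
      ... | yes refl = trans (undecided (here refl)) (sym σt≡nothing)
      ... | no x≢t   = decided (∉-∷⁺ x≢t x∉U)

    completion-assign : ∀ {j} → t ∉ U → σ t ≡ just j → Completion U (decr rem j) (assign s t j) σ
    completion-assign {j} t∉U σt≡j = record
      { feasible  = feasible
      ; remaining = λ k → decr-remaining rem j k (remaining-∷ σt≡j k)
      ; undecided = λ x∈U → trans (update-≢ s (just j) λ { refl → t∉U x∈U }) (undecided (there x∈U))
      ; decided   = decided′
      }
      where
      decided′ : ∀ {x} → x ∉ U → assign s t j x ≡ σ x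
      decided′ {x} x∉U with x ≟ t
      ... | yes refl = trans (update-≡ s t (just j)) (sym σt≡j)
      ... | no x≢t   = trans (update-≢ s (just j) x≢t) (decided (∉-∷⁺ x≢t x∉U))

    completion-relocate : ∀ {rank j t'} → Unique (t ∷ U) → t' ∈ U → σ t' ≡ just j → isJob (σ t) j ≡ false →
      Fits (J j) t → (∀ {k} → σ t ≡ just k → rank j ≤ rank k) → Exchangeable rank t t' →
      Completion (t ∷ U) rem s (swapSlots σ t t') × swapSlots σ t t' t ≡ just j × idle σ ≤ idle (swapSlots σ t t')
    completion-relocate {rank} {j} {t'} unique@(t∉U ∷ _) t'∈U σt'≡j σt≟j fits[j,t] minimal exchangeable =
      completion-swapSlots c unique t≢t' (here refl) (there t'∈U) feasible′ ,
      trans (swapSlots-≡ˡ σ t≢t') σt'≡j ,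
      count-swapSlots-≤ is-nothing σ (range-unique te l) t≢t' window-closed (cong is-nothing σt'≡j)
      where
      open Exchangeable exchangeable
      t≢t' : t ≢ t'
      t≢t' refl = All.lookup t∉U t'∈U refl
      admissible : Admissible J H (σ t') t
      admissible = admissible-just J σt'≡j
        (≤-trans (proj₁ (intervals j)) (proj₁ fits[j,t]) , ≤-trans (proj₂ fits[j,t]) (proj₂ (intervals j)) , fits[j,t])
      admissible′ : Admissible J H (σ t) t'
      admissible′ k σt≡k with proj₁ feasible t' j σt'≡j
      ... | 1≤t' , t'≤H , fits[j,t'] = 1≤t' , t'≤H , relocatable (minimal σt≡k) j≢k fits[k,t] fits[j,t']
        where
        fits[k,t] = proj₂ (proj₂ (proj₁ feasible t k σt≡k))
        j≢k : j ≢ k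
        j≢k refl = case trans (sym σt≟j) (trans (cong (λ c → isJob c j) σt≡k) (isJob-self j)) of λ ()
      feasible′ = feasible-swapSlots J feasible t≢t' σt'≡j admissible admissible′

    completion-exchange : ∀ {rank j} → Unique (t ∷ U) → T (available J rem t j) →
      (∀ k → T (available J rem t k) → rank j ≤ rank k) → (∀ {t'} → t' ∈ U → Exchangeable rank t t') →
      ∃[ σ' ] Completion (t ∷ U) rem s σ' × σ' t ≡ just j × idle σ ≤ idle σ'
    completion-exchange {rank} {j} unique available[j] minimal exchangeable with isJob (σ t) j in σt≟j
    ... | true  = σ , c , isJob⇒≡ (σ t) σt≟j , ≤-refl
    ... | false with count-witness (λ x → isJob (σ x) j) U
                       (subst (0 <_) (trans (remaining-∷ refl j) (cong (λ b → indicator b + later j) σt≟j))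
                                     (proj₂ (available⁻ J {rem} available[j])))
    ...   | t' , t'∈U , σt'≟j = swapSlots σ t t' ,
      completion-relocate unique t'∈U (isJob⇒≡ (σ t') σt'≟j) σt≟j (proj₁ (available⁻ J {rem} available[j]))
        (minimal _ ∘ occupant-available) (exchangeable t'∈U)

  ImprovingCompletion : List ℕ → (Fin n → ℕ) × Schedule n → Schedule n → Set
  ImprovingCompletion U (rem , s) σ = ∃[ σ' ] Completion U rem s σ' × idle σ ≤ idle σ'

  sweep : ∀ rank {_≺_ : ℕ → ℕ → Set} → (∀ {t} → ¬ t ≺ t) → ∀ ts {rest rem s σ} →
    AllPairs _≺_ (ts ++ rest) → (∀ {t t'} → t ∈ ts → t ≺ t' → Exchangeable rank t t') →
    Completion (ts ++ rest) rem s σ → ImprovingCompletion rest (runSlots J rank ts rem s) σ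
  sweep rank irrefl [] {σ = σ} _ _ c = σ , c , ≤-refl
  sweep rank {_≺_} irrefl (t ∷ ts) {rest} {rem} (t≺ ∷ sorted) exchangeable c
    with selectMin rank (available J rem t) | selectMin-argmin rank (available J rem t)
  ... | nothing | none unavailable =
    sweep rank irrefl ts sorted (exchangeable ∘ there) (completion-skip c (unavailable ∘ ∈-allFin))
  ... | just j  | some available[j] minimal
    with completion-exchange c unique available[j] (minimal ∘ ∈-allFin) (exchangeable (here refl) ∘ All.lookup t≺)
    where
    unique : Unique (t ∷ ts ++ rest)
    unique = AllPairs.map (λ { t≺t' refl → irrefl t≺t' }) (t≺ ∷ sorted)
  ...   | σ₁ , c₁ , σ₁t≡j , σ≤σ₁
    with sweep rank irrefl ts sorted (exchangeable ∘ there) (completion-assign c₁ (irrefl ∘ All.lookup t≺) σ₁t≡j)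
  ...     | σ' , c' , σ₁≤σ' = σ' , c' , ≤-trans σ≤σ₁ σ₁≤σ'

  stage₁ : ∀ π {σ} → AscDeadline J π → 1 ≤ te → te ≤ suc H → Feasible J H σ →
    ImprovingCompletion (range te (suc H ∸ te))
      (runSlots J (λ j → toℕ (π ⟨$⟩ʳ j)) (range 1 (te ∸ 1)) (λ j → p (J j)) (λ _ → nothing)) σ
  stage₁ π asc 1≤te te≤1+H feasible =
    sweep (λ j → toℕ (π ⟨$⟩ʳ j)) (<-irrefl refl) (range 1 (te ∸ 1))
      (subst (AllPairs _<_) (sym split) (range-increasing 1 H))
      (λ t∈ t<t' → exchangeable (subst (_ <_) (m+[n∸m]≡n 1≤te) (proj₂ (∈-range⁻ t∈))) t<t')
      (subst (λ U → Completion U _ _ _) (sym split) (initial-completion feasible))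
    where
    split = range-split 1≤te te≤1+H
    exchangeable : ∀ {t t'} → t < te → t < t' → Exchangeable (λ j → toℕ (π ⟨$⟩ʳ j)) t t'
    exchangeable t<te t<t' = record
      { relocatable   = λ {j} {k} π[j]≤π[k] j≢k (r[k]≤t , _) (_ , t'≤d[j]) →
          ≤-trans r[k]≤t (<⇒≤ t<t') ,
          ≤-trans t'≤d[j] (asc j k (≤∧≢⇒< π[j]≤π[k] (j≢k ∘ permute-injective π)))
      ; window-closed = λ t∈window → contradiction (proj₁ (∈-range⁻ t∈window)) (<⇒≱ t<te)
      }

  stage₂ : ∀ π̄ ĵ {k rem s σ} → DescRelease J π̄ → r (J ĵ) ≤ te → Completion (range te k) rem s σ →
    ImprovingCompletion [] (runSlots J (moveLast π̄ ĵ) (reverse (range te k)) rem s) σ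
  stage₂ π̄ ĵ {k} desc r[ĵ]≤te c =
    sweep (moveLast π̄ ĵ) (<-irrefl refl ∘ proj₂) (reverse (range te k))
      (subst (AllPairs _≻_) (sym (trans (++-identityʳ _) (reverse-range te k)))
        (applyDownFrom⁺₁ (te +_) k (λ i<j _ → m≤m+n te _ , +-monoʳ-< te i<j)))
      (λ _ → exchangeable)
      (completion-resp-↭ (↭-sym (↭-trans (↭-reflexive (++-identityʳ _)) (↭-reverse _))) c)
    where
    _≻_ : ℕ → ℕ → Set
    t ≻ t' = te ≤ t' × t' < t
    exchangeable : ∀ {t t'} → t ≻ t' → Exchangeable (moveLast π̄ ĵ) t t'
    exchangeable {t} {t'} (te≤t' , t'<t) = record
      { relocatable   = λ {j} {k} j≤k j≢k (_ , t≤d[k]) (r[j]≤t' , _) → released j k j≤k j≢k r[j]≤t' , ≤-trans (<⇒≤ t'<t) t≤d[k]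
      ; window-closed = λ t∈window → ∈-range⁺ te≤t' (<-trans t'<t (proj₂ (∈-range⁻ t∈window)))
      }
      where
      released : ∀ j k → moveLast π̄ ĵ j ≤ moveLast π̄ ĵ k → j ≢ k → r (J j) ≤ t' → r (J k) ≤ t'
      released j k j≤k j≢k r[j]≤t' = case k Fin.≟ ĵ of λ where
        (yes refl) → ≤-trans r[ĵ]≤te te≤t'
        (no k≢ĵ)   → ≤-trans (desc j k (moveLast-≤⇒< π̄ ĵ k≢ĵ j≢k j≤k)) r[j]≤t'

  algorithm-improves : ∀ π π̄ ĵ {σ} → AscDeadline J π → DescRelease J π̄ → r (J ĵ) ≤ te → 1 ≤ te → te ≤ suc H →
    Feasible J H σ → Feasible J H (algorithm J H te π π̄ ĵ) × idle σ ≤ idle (algorithm J H te π π̄ ĵ)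
  algorithm-improves π π̄ ĵ asc desc r[ĵ]≤te 1≤te te≤1+H feasible
    with stage₁ π asc 1≤te te≤1+H feasible
  ... | σ₁ , c₁ , σ≤σ₁ with stage₂ π̄ ĵ desc r[ĵ]≤te c₁
  ... | σ₂ , c₂ , σ₁≤σ₂ with completion-[] c₂
  ... | feasible-alg , alg≡σ₂ = feasible-alg , ≤-trans σ≤σ₁ (≤-trans σ₁≤σ₂ (≤-reflexive (sym alg≡σ₂)))

lemma13 : (n H : ℕ) (J : Fin n → Job) →
    (∀ j → (1 ≤ r (J j)) × (d (J j) ≤ H) × (p (J j) ≤ suc (d (J j)) ∸ r (J j))) →
    ∃ (λ s → Feasible J H s) →
    (te l : ℕ) → 1 ≤ te → te + l ≤ suc H →
    (π π̄ : Permutation′ n) → AscDeadline J π → DescRelease J π̄ →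
    (ĵ : Fin n) → r (J ĵ) ≤ te → te ≤ d (J ĵ) →
    Optimal J H te l (algorithm J H te π π̄ ĵ)
lemma13 n H J jobs (σ₀ , feasible₀) te l 1≤te te+l≤1+H π π̄ asc desc ĵ r[ĵ]≤te _ =
  proj₁ (improves feasible₀) , λ σ feasible → proj₂ (improves feasible)
  where
  open Exchange J H te l (λ j → proj₁ (jobs j) , proj₁ (proj₂ (jobs j)))
  improves : ∀ {σ} → Feasible J H σ →
    Feasible J H (algorithm J H te π π̄ ĵ) × idle σ ≤ idle (algorithm J H te π π̄ ĵ)
  improves = algorithm-improves π π̄ ĵ asc desc r[ĵ]≤te 1≤te (≤-trans (m≤m+n te l) te+l≤1+H)
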